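{- Let $n$, $k$, $t$ and $s$ be positive integers with $k\geq t+2$ and $n\geq 2k+s$. Suppose $\mathcal{F}\subseteq \binom{[n]}{k}$ is a maximal $s$-almost $t$-intersecting family with $\tau_{t}(\mathcal{F})\leq k$. If $\mathcal{T}$ is the set of all $t$-covers of $\mathcal{F}$ of size $\tau_{t}(\mathcal{F})$, then $\mathcal{T}$ is $t$-intersecting.
   Context: $\mathcal{F}\subseteq\binom{[n]}{k}$ is $s$-almost $t$-intersecting if $\left|\{F'\in\mathcal{F}: |F'\cap F|<t\}\right|\leq s$ for every $F\in\mathcal{F}$; it is maximal if no $C\in\binom{[n]}{k}\setminus\mathcal{F}$ makes $\mathcal{F}\cup\{C\}$ $s$-almost $t$-intersecting. A family is $t$-intersecting if any two of its members share at least $t$ elements. A set $T\subseteq[n]$ is a $t$-cover of $\mathcal{F}$ if $|T\cap F|\geq t$ for all $F\in\mathcal{F}$; $\tau_t(\mathcal{F})$ is the minimum size of a $t$-cover. -}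

module Defs where

open import Data.Nat using (ℕ; zero; suc; _≤_; _<ᵇ_)
open import Data.Bool using (Bool; true; false; _∧_; _∨_)
import Data.Bool.Properties as BoolP
open import Data.Vec using (Vec; []; _∷_)
open import Data.Vec.Properties using (≡-dec)
open import Data.List using (List; []; _∷_; map; _++_; length; filter)
open import Data.Fin.Subset using (Subset; _∩_; ∣_∣)
open import Data.Product using (Σ; _×_)
open import Relation.Nullary using (¬_)
open import Relation.Nullary.Decidable using (⌊_⌋)
open import Relation.Binary.PropositionalEquality using (_≡_)

-- All subsets of [n] (as characteristic vectors), each listed exactly once.
allSubsets : (n : ℕ) → List (Subset n)
allSubsets zero = [] ∷ []
allSubsets (suc n) = map (false ∷_) (allSubsets n) ++ map (true ∷_) (allSubsets n)

Family : ℕ → Set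
Family n = Subset n → Bool

count : {n : ℕ} → (Subset n → Bool) → ℕ
count {n} P = length (filter (λ A → P A BoolP.≟ true) (allSubsets n))

Uniform : {n : ℕ} → ℕ → Family n → Set
Uniform {n} k F = (A : Subset n) → F A ≡ true → ∣ A ∣ ≡ k

AlmostIntersecting : {n : ℕ} → ℕ → ℕ → Family n → Set
AlmostIntersecting {n} s t F =
  (A : Subset n) → F A ≡ true → count (λ B → F B ∧ (∣ B ∩ A ∣ <ᵇ t)) ≤ s

insert : {n : ℕ} → Subset n → Family n → Family n
insert C F B = F B ∨ ⌊ ≡-dec BoolP._≟_ B C ⌋

MaximalAlmostIntersecting : {n : ℕ} → ℕ → ℕ → ℕ → Family n → Set
MaximalAlmostIntersecting {n} k s t F =
  Uniform k F × AlmostIntersecting s t F ×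
  ((C : Subset n) → ∣ C ∣ ≡ k → F C ≡ false → ¬ AlmostIntersecting s t (insert C F))

IsCover : {n : ℕ} → ℕ → Family n → Subset n → Set
IsCover {n} t F T = (A : Subset n) → F A ≡ true → t ≤ ∣ T ∩ A ∣

IsCoverNumber : {n : ℕ} → ℕ → Family n → ℕ → Set
IsCoverNumber {n} t F m =
  Σ (Subset n) (λ T → IsCover t F T × ∣ T ∣ ≡ m) ×
  ((T : Subset n) → IsCover t F T → m ≤ ∣ T ∣)

TIntersecting : {n : ℕ} → ℕ → (Subset n → Set) → Set
TIntersecting {n} t 𝒯 = (A B : Subset n) → 𝒯 A → 𝒯 B → t ≤ ∣ A ∩ B ∣

{-# OPTIONS --safe #-}
module Submission where

-- Pad a t-cover T of size τ to a k-set C by adding points outside another such cover U.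
-- Then C is a k-uniform t-cover of F, so it t-intersects every member of F ∪ {C}, including
-- itself; adding C therefore creates no new pairs meeting in fewer than t points, and
-- maximality forces C ∈ F. As U covers C and C ∖ T misses U, t ≤ ∣U ∩ C∣ ≤ ∣T ∩ U∣.

open import Defs
open import Data.Nat using (ℕ; suc; _≤_; _+_; _*_; _∸_; _<ᵇ_; z≤n; s≤s)
open import Data.Nat.Properties
open import Data.Bool using (Bool; true; false; _∧_)
open import Data.Bool.Properties using (¬-not; not-¬; T-≡) renaming (_≟_ to _≟ᵇ_)
open import Data.Vec using ([]; _∷_; here)
open import Data.Vec.Properties using (≡-dec)
open import Data.List using (length)
open import Data.List.Properties using (filter-≐; filter-none)
open import Data.List.Relation.Unary.All using (universal)
open import Data.Fin.Subset using (Subset; ∣_∣; _∩_; _∪_; ∁; _⊆_; inside; outside)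
open import Data.Fin.Subset.Properties
open import Data.Product using (_×_; _,_; ∃-syntax; map₁)
open import Data.Sum using (_⊎_; inj₁; inj₂)
open import Function using (_∘_; const; Equivalence)
open import Relation.Nullary using (yes; no; contradiction)
open import Relation.Binary.PropositionalEquality using (_≡_; _≗_; refl; sym; trans; cong; subst)

private
  variable
    n k s t : ℕ
    F : Family n
    C T U : Subset n

<ᵇ-false : ∀ {m o} → o ≤ m → (m <ᵇ o) ≡ false
<ᵇ-false {m} {o} o≤m = ¬-not (λ m<ᵇo → <⇒≱ (<ᵇ⇒< m o (Equivalence.from T-≡ m<ᵇo)) o≤m)

∃-⊆-between : ∀ {m} {p q : Subset n} → p ⊆ q → ∣ p ∣ ≤ m → m ≤ ∣ q ∣ →
              ∃[ r ] p ⊆ r × r ⊆ q × ∣ r ∣ ≡ m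
∃-⊆-between {p = []} {[]} _ z≤n z≤n = [] , ⊆-refl , ⊆-refl , refl
∃-⊆-between {p = inside ∷ p} {outside ∷ q} p⊆q _ _ with () ← p⊆q here
∃-⊆-between {p = inside ∷ p} {inside ∷ q} p⊆q (s≤s ∣p∣≤m) (s≤s m≤∣q∣)
  with r , p⊆r , r⊆q , ∣r∣≡m ← ∃-⊆-between (drop-∷-⊆ p⊆q) ∣p∣≤m m≤∣q∣
  = inside ∷ r , in⊆in p⊆r , in⊆in r⊆q , cong suc ∣r∣≡m
∃-⊆-between {p = outside ∷ p} {outside ∷ q} p⊆q ∣p∣≤m m≤∣q∣
  with r , p⊆r , r⊆q , ∣r∣≡m ← ∃-⊆-between (drop-∷-⊆ p⊆q) ∣p∣≤m m≤∣q∣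
  = outside ∷ r , out⊆ p⊆r , out⊆ r⊆q , ∣r∣≡m
∃-⊆-between {p = outside ∷ p} {inside ∷ q} p⊆q ∣p∣≤m m≤1+∣q∣ with m≤n⇒m<n∨m≡n m≤1+∣q∣
... | inj₂ refl = inside ∷ q , out⊆ (drop-∷-⊆ p⊆q) , ⊆-refl , refl
... | inj₁ (s≤s m≤∣q∣)
  with r , p⊆r , r⊆q , ∣r∣≡m ← ∃-⊆-between (drop-∷-⊆ p⊆q) ∣p∣≤m m≤∣q∣
  = outside ∷ r , out⊆ p⊆r , out⊆ r⊆q , ∣r∣≡m

⊆∪∁⇒∩⊆∩ : ∀ (p q : Subset n) {r} → r ⊆ p ∪ ∁ q → q ∩ r ⊆ p ∩ q
⊆∪∁⇒∩⊆∩ p q {r} r⊆p∪∁q x∈q∩r with x∈p∩q⁻ q r x∈q∩r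
... | x∈q , x∈r with x∈p∪q⁻ p (∁ q) (r⊆p∪∁q x∈r)
...   | inj₁ x∈p  = x∈p∩q⁺ (x∈p , x∈q)
...   | inj₂ x∈∁q = contradiction x∈q (x∈∁p⇒x∉p x∈∁q)

count-cong : {P Q : Subset n → Bool} → P ≗ Q → count P ≡ count Q
count-cong {n} {P} {Q} P≗Q = cong length
  (filter-≐ (λ A → P A ≟ᵇ true) (λ A → Q A ≟ᵇ true)
    ((λ {A} → trans (sym (P≗Q A))) , (λ {A} → trans (P≗Q A)))
    (allSubsets n))

count-none : {P : Subset n → Bool} → P ≗ const false → count P ≡ 0
count-none {n} {P} P≗false =
  cong length (filter-none (λ A → P A ≟ᵇ true) (universal (not-¬ ∘ P≗false) (allSubsets n)))

IsCover-⊆ : T ⊆ C → IsCover t F T → IsCover t F C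
IsCover-⊆ {T = T} {C} T⊆C T-cover A FA =
  ≤-trans (T-cover A FA) (p⊆q⇒∣p∣≤∣q∣ (x∈p∩q⁺ ∘ map₁ T⊆C ∘ x∈p∩q⁻ T A))

misses : ℕ → Family n → Subset n → Family n
misses t F A B = F B ∧ (∣ B ∩ A ∣ <ᵇ t)

misses-insert : ∀ F (C A : Subset n) → t ≤ ∣ C ∩ A ∣ → misses t (insert C F) A ≗ misses t F A
misses-insert F C A t≤∣C∩A∣ B with F B | ≡-dec _≟ᵇ_ B C
... | true  | _        = refl
... | false | yes refl = <ᵇ-false t≤∣C∩A∣
... | false | no _     = refl

misses-cover : ∀ F (C : Subset n) → IsCover t F C → misses t F C ≗ const false
misses-cover {t = t} F C C-cover B with F B in FB
... | true  = <ᵇ-false (subst (λ X → t ≤ ∣ X ∣) (∩-comm C B) (C-cover B FB))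
... | false = refl

∈-insert⁻ : ∀ (C : Subset n) F A → insert C F A ≡ true → F A ≡ true ⊎ A ≡ C
∈-insert⁻ C F A A∈ with F A | ≡-dec _≟ᵇ_ A C
... | true  | _        = inj₁ refl
... | false | yes A≡C  = inj₂ A≡C
... | false | no _     = contradiction A∈ λ ()

insert-AlmostIntersecting : AlmostIntersecting s t F → IsCover t F C → t ≤ ∣ C ∣ →
                            AlmostIntersecting s t (insert C F)
insert-AlmostIntersecting {s = s} {t = t} {F = F} {C = C} almost C-cover t≤∣C∣ A A∈
  with ∈-insert⁻ C F A A∈
... | inj₁ FA   = subst (_≤ s) (sym (count-cong (misses-insert F C A (C-cover A FA)))) (almost A FA)
... | inj₂ refl = ≤-trans (≤-reflexive no-misses) z≤n
  where
  t≤∣C∩C∣ : t ≤ ∣ C ∩ C ∣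
  t≤∣C∩C∣ = subst (λ X → t ≤ ∣ X ∣) (sym (∩-idem C)) t≤∣C∣
  no-misses : count (misses t (insert C F) C) ≡ 0
  no-misses = trans (count-cong (misses-insert F C C t≤∣C∩C∣))
                    (count-none (misses-cover F C C-cover))

cover∈maximal : MaximalAlmostIntersecting k s t F → t ≤ k →
                IsCover t F C → ∣ C ∣ ≡ k → F C ≡ true
cover∈maximal {t = t} {F = F} {C} (_ , almost , maximal) t≤k C-cover ∣C∣≡k with F C in FC
... | true  = refl
... | false = contradiction
  (insert-AlmostIntersecting almost C-cover (subst (t ≤_) (sym ∣C∣≡k) t≤k))
  (maximal C ∣C∣≡k FC)

covers-intersect : MaximalAlmostIntersecting k s t F → t ≤ k →
                   IsCover t F T → IsCover t F U → ∣ T ∣ ≤ k → k ≤ ∣ T ∪ ∁ U ∣ →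
                   t ≤ ∣ T ∩ U ∣
covers-intersect {T = T} {U = U} maximal t≤k T-cover U-cover ∣T∣≤k k≤∣T∪∁U∣
  with C , T⊆C , C⊆T∪∁U , ∣C∣≡k ← ∃-⊆-between (p⊆p∪q {p = T} (∁ U)) ∣T∣≤k k≤∣T∪∁U∣
  = ≤-trans (U-cover C C∈F) (p⊆q⇒∣p∣≤∣q∣ (⊆∪∁⇒∩⊆∩ T U C⊆T∪∁U))
  where C∈F = cover∈maximal maximal t≤k (IsCover-⊆ T⊆C T-cover) ∣C∣≡k

lemma4p1 : (n k t s : ℕ) → 1 ≤ n → 1 ≤ k → 1 ≤ t → 1 ≤ s →
    t + 2 ≤ k → 2 * k + s ≤ n →
    (F : Family n) → MaximalAlmostIntersecting k s t F →
    (τ : ℕ) → IsCoverNumber t F τ → τ ≤ k →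
    TIntersecting t (λ T → IsCover t F T × ∣ T ∣ ≡ τ)
lemma4p1 n k t s _ _ _ _ t+2≤k 2k+s≤n F maximal τ _ τ≤k T U (T-cover , ∣T∣≡τ) (U-cover , ∣U∣≡τ) =
  covers-intersect {T = T} {U = U} maximal (≤-trans (m≤m+n t 2) t+2≤k) T-cover U-cover
    (subst (_≤ k) (sym ∣T∣≡τ) τ≤k) k≤∣T∪∁U∣
  where
  open ≤-Reasoning
  k+τ≤n : k + τ ≤ n
  k+τ≤n = ≤-trans (+-monoʳ-≤ k (≤-trans τ≤k (m≤m+n k 0))) (≤-trans (m≤m+n (2 * k) s) 2k+s≤n)
  k≤∣T∪∁U∣ : k ≤ ∣ T ∪ ∁ U ∣
  k≤∣T∪∁U∣ = begin
    k              ≤⟨ m+n≤o⇒m≤o∸n k k+τ≤n ⟩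
    n ∸ τ          ≡⟨ cong (n ∸_) (sym ∣U∣≡τ) ⟩
    n ∸ ∣ U ∣      ≡⟨ sym (∣∁p∣≡n∸∣p∣ U) ⟩
    ∣ ∁ U ∣        ≤⟨ ∣q∣≤∣p∪q∣ T (∁ U) ⟩
    ∣ T ∪ ∁ U ∣    ∎
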